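{- Let $(A,*)$ be an associative rectangular groupoid, and let $I=\{x*y: x,y\in A\}$. Then $I$ is a subsemigroup of $A$ and $(I,*)$ is a rectangular band. Moreover, if $I=A$ then $A$ is a rectangular band, and otherwise $A$ is a blow up of $I$.
   Context: A groupoid $(A,*)$ is a rectangular groupoid if for all $a,b,c,d,x\in A$: $a*b=c*d=x$ implies $a*d=c*b=x$. A rectangular band is a semigroup $(S,*)$ that is idempotent ($a*a=a$) and satisfies $a*b*c=a*c$ for all $a,b,c\in S$. If $(A,*)$ is a rectangular groupoid and $I\subsetneq A$ is such that $a*b\in I$ for all $a,b\in A$, then $A$ is called a blow up of $I$. -}

module Defs where

open import Level using (Level; _⊔_)
open import Data.Product using (Σ; ∃; ∃-syntax; _×_; _,_)
open import Relation.Binary.PropositionalEquality using (_≡_)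
open import Relation.Nullary using (¬_)
open import Algebra.Definitions using (Associative)

private variable ℓ : Level

IsRectangularGroupoid : {A : Set ℓ} → (A → A → A) → Set ℓ
IsRectangularGroupoid {A = A} _*_ =
  ∀ (a b c d x : A) → a * b ≡ x → c * d ≡ x → (a * d ≡ x) × (c * b ≡ x)

IsRectangularBand : {A : Set ℓ} → (A → A → A) → Set ℓ
IsRectangularBand {A = A} _*_ =
  Associative _≡_ _*_ × (∀ (a : A) → a * a ≡ a)
    × (∀ (a b c : A) → (a * b) * c ≡ a * c)

Subset : Set ℓ → Set (Level.suc ℓ)
Subset {ℓ} A = A → Set ℓ

Products : {A : Set ℓ} → (A → A → A) → Subset A
Products {A = A} _*_ z = ∃[ x ] ∃[ y ] (x * y ≡ z)

-- P is closed under * (a subsemigroup, when * is associative)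
IsSubsemigroup : {A : Set ℓ} → (A → A → A) → Subset A → Set ℓ
IsSubsemigroup {A = A} _*_ P = ∀ (x y : A) → P x → P y → P (x * y)

-- (P, *) is a rectangular band: the band laws for all elements of P
-- (assumes P closed under *; equality is that of A)
IsRectangularBandOn : {A : Set ℓ} → (A → A → A) → Subset A → Set ℓ
IsRectangularBandOn {A = A} _*_ P =
  (∀ (a b c : A) → P a → P b → P c → (a * b) * c ≡ a * (b * c))
  × (∀ (a : A) → P a → a * a ≡ a)
  × (∀ (a b c : A) → P a → P b → P c → (a * b) * c ≡ a * c)

IsProperSubset : {A : Set ℓ} → Subset A → Set ℓ
IsProperSubset {A = A} I = ¬ (∀ (a : A) → I a)

IsBlowUpOf : {A : Set ℓ} → (A → A → A) → Subset A → Set ℓ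
IsBlowUpOf {A = A} _*_ I =
  IsRectangularGroupoid _*_ × IsProperSubset I × (∀ (a b : A) → I (a * b))

module Submission where

-- In an associative rectangular groupoid (A, *) everything
-- follows from one identity, the rectangular law  (a * b) * c ≡ a * c:
-- the two factorisations  a * (b * c)  and  (a * b) * c  of the same
-- element, fed to rectangularity, give  a * c  equal to it.  From it,
-- every product is idempotent, since (x*y)*(x*y) = ((x*y)*x)*y = (x*x)*y
-- = x*y.  Hence on the set I of products all rectangular-band laws hold
-- (I is trivially closed under *); if I = A the laws hold on all of A;
-- and if I ≠ A, then A is a blow up of I by definition, because every
-- product lies in I.

open import Defs
open import Level using (Level)
open import Data.Product using (_×_; _,_; proj₁)
open import Relation.Binary.PropositionalEquality
  using (_≡_; refl; sym; cong; module ≡-Reasoning)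
open import Relation.Nullary using (¬_)
open import Algebra.Definitions using (Associative)

product∈Products : ∀ {ℓ} {A : Set ℓ} (_*_ : A → A → A) (x y : A) →
                   Products _*_ (x * y)
product∈Products _*_ x y = x , y , refl

module AssociativeRectangular
  {ℓ : Level} {A : Set ℓ} (_*_ : A → A → A)
  (assoc : Associative _≡_ _*_) (rect : IsRectangularGroupoid _*_) where

  -- The rectangular law: the middle factor of a triple product is irrelevant.
  -- Rectangularity applied to  a * (b * c) ≡ (a * b) * c  swaps the
  -- outer factors and yields  a * c ≡ (a * b) * c.
  rectangularLaw : ∀ a b c → (a * b) * c ≡ a * c
  rectangularLaw a b c =
    sym (proj₁ (rect a (b * c) (a * b) c ((a * b) * c) (sym (assoc a b c)) refl))

  productIdempotent : ∀ x y → (x * y) * (x * y) ≡ x * y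
  productIdempotent x y = begin
    (x * y) * (x * y)  ≡⟨ sym (assoc (x * y) x y) ⟩
    ((x * y) * x) * y  ≡⟨ cong (_* y) (rectangularLaw x y x) ⟩
    (x * x) * y        ≡⟨ rectangularLaw x x y ⟩
    x * y              ∎
    where open ≡-Reasoning

  idempotentOnProducts : ∀ a → Products _*_ a → a * a ≡ a
  idempotentOnProducts _ (x , y , refl) = productIdempotent x y

  productsRectangularBand : IsRectangularBandOn _*_ (Products _*_)
  productsRectangularBand =
      (λ a b c _ _ _ → assoc a b c)
    , idempotentOnProducts
    , (λ a b c _ _ _ → rectangularLaw a b c)

  rectangularBandIfSurjective :
    (∀ a → Products _*_ a) → IsRectangularBand _*_
  rectangularBandIfSurjective allProducts =
    assoc , (λ a → idempotentOnProducts a (allProducts a)) , rectangularLaw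

mainTheorem5 : ∀ {ℓ : Level} (A : Set ℓ) (_*_ : A → A → A)
    → Associative _≡_ _*_
    → IsRectangularGroupoid _*_
    → IsSubsemigroup _*_ (Products _*_)
    × IsRectangularBandOn _*_ (Products _*_)
    × ((∀ (a : A) → Products _*_ a) → IsRectangularBand _*_)
    × (¬ (∀ (a : A) → Products _*_ a) → IsBlowUpOf _*_ (Products _*_))
mainTheorem5 A _*_ assoc rect =
    (λ x y _ _ → product∈Products _*_ x y)
  , productsRectangularBand
  , rectangularBandIfSurjective
  , (λ proper → rect , proper , product∈Products _*_)
  where open AssociativeRectangular _*_ assoc rect
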